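{- Let $\phi$ be a non-special Gallai coloring of $K_5$ that uses exactly three colors and has a monochromatic vertex. Then $w(\phi)\le 31$.
   Context: A Gallai coloring of $K_m$ is a coloring $E(K_m)\to\{\text{red},\text{green},\text{blue}\}$ with no rainbow triangle (triangle whose three edges have three distinct colors). For a Gallai coloring $\psi$ of $K_m$, regard $K_{m+1}$ as $K_m$ plus a new vertex $u$; $w(\psi)$ is the number of colorings of the edges from $u$ to $V(K_m)$ with colors in $\{\text{red},\text{green},\text{blue}\}$ such that the resulting coloring of $E(K_{m+1})$ is Gallai. A vertex is monochromatic if all its incident edges have the same color. A coloring with exactly three colors is vertex-special if there is a vertex $v$ monochromatic in some color $c$ and the coloring of $K_m-v$ uses only the two colors other than $c$, with all its edges of one of them except exactly one edge of the other; it is edge-special if there are two non-adjacent edges of two different colors and all other edges have the third color; it is non-special if it is neither. -}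

module Defs where

open import Data.Nat using (ℕ; zero; suc)
open import Data.Fin using (Fin; zero; suc)
open import Data.Fin.Properties using (all?) renaming (_≟_ to _≟F_)
open import Data.List using (List; []; _∷_; map; concatMap; filter; length)
open import Data.Product using (Σ; ∃; ∃-syntax; _×_; _,_)
open import Data.Sum using (_⊎_)
open import Relation.Nullary using (¬_; Dec; yes; no; ¬?)
open import Relation.Nullary.Decidable using (_×-dec_; _→-dec_)
open import Relation.Binary.PropositionalEquality using (_≡_; _≢_; refl)

data Color : Set where
  red green blue : Color

_≟C_ : (a b : Color) → Dec (a ≡ b)
red ≟C red = yes refl
red ≟C green = no λ ()
red ≟C blue = no λ ()
green ≟C red = no λ ()
green ≟C green = yes refl
green ≟C blue = no λ ()
blue ≟C red = no λ ()
blue ≟C green = no λ ()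
blue ≟C blue = yes refl

-- An edge colouring of K_m: a colour for each ordered pair; only values on
-- pairs of distinct vertices matter, and we require symmetry separately.
Coloring : ℕ → Set
Coloring m = Fin m → Fin m → Color

Symmetric : ∀ {m} → Coloring m → Set
Symmetric {m} c = ∀ (i j : Fin m) → c i j ≡ c j i

Rainbow : Color → Color → Color → Set
Rainbow a b d = a ≢ b × b ≢ d × a ≢ d

Gallai : ∀ {m} → Coloring m → Set
Gallai {m} c = ∀ (i j k : Fin m) → i ≢ j → j ≢ k → i ≢ k →
  ¬ Rainbow (c i j) (c j k) (c i k)

gallai? : ∀ {m} (c : Coloring m) → Dec (Gallai c)
gallai? c = all? λ i → all? λ j → all? λ k →
  ¬? (i ≟F j) →-dec (¬? (j ≟F k) →-dec (¬? (i ≟F k) →-dec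
    ¬? (¬? (c i j ≟C c j k) ×-dec (¬? (c j k ≟C c i k) ×-dec ¬? (c i j ≟C c i k)))))

-- K_{m+1} = K_m plus a new vertex u (= zero); f gives the colours of the
-- edges from u to V(K_m).
extend : ∀ {m} → Coloring m → (Fin m → Color) → Coloring (suc m)
extend c f zero zero = red
extend c f zero (suc j) = f j
extend c f (suc i) zero = f i
extend c f (suc i) (suc j) = c i j

allColorFns : (m : ℕ) → List (Fin m → Color)
allColorFns zero = (λ ()) ∷ []
allColorFns (suc m) = concatMap (λ f → map (λ a → cons a f) (red ∷ green ∷ blue ∷ [])) (allColorFns m)
  where
  cons : Color → (Fin m → Color) → Fin (suc m) → Color
  cons a f zero = a
  cons a f (suc i) = f i

w : ∀ {m} → Coloring m → ℕ
w {m} c = length (filter (λ f → gallai? (extend c f)) (allColorFns m))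

UsesThreeColors : ∀ {m} → Coloring m → Set
UsesThreeColors {m} c = ∀ (col : Color) → ∃[ i ] ∃[ j ] (i ≢ j × c i j ≡ col)

MonochromaticIn : ∀ {m} → Coloring m → Fin m → Color → Set
MonochromaticIn {m} c v col = ∀ (x : Fin m) → x ≢ v → c v x ≡ col

HasMonochromaticVertex : ∀ {m} → Coloring m → Set
HasMonochromaticVertex {m} c = ∃[ v ] ∃[ col ] MonochromaticIn c v col

SameEdge : ∀ {m} → Fin m → Fin m → Fin m → Fin m → Set
SameEdge p q x y = (p ≡ x × q ≡ y) ⊎ (p ≡ y × q ≡ x)

VertexSpecial : ∀ {m} → Coloring m → Set
VertexSpecial {m} c =
  ∃[ v ] ∃[ col ] ∃[ a ] ∃[ b ] ∃[ x ] ∃[ y ]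
    (MonochromaticIn c v col × Rainbow col a b ×
     x ≢ y × x ≢ v × y ≢ v × c x y ≡ b ×
     (∀ (p q : Fin m) → p ≢ q → p ≢ v → q ≢ v → ¬ SameEdge p q x y → c p q ≡ a))

EdgeSpecial : ∀ {m} → Coloring m → Set
EdgeSpecial {m} c =
  ∃[ x ] ∃[ y ] ∃[ z ] ∃[ t ] ∃[ a ] ∃[ b ] ∃[ d ]
    (x ≢ y × x ≢ z × x ≢ t × y ≢ z × y ≢ t × z ≢ t ×
     Rainbow a b d × c x y ≡ a × c z t ≡ b ×
     (∀ (p q : Fin m) → p ≢ q → ¬ SameEdge p q x y → ¬ SameEdge p q z t → c p q ≡ d))

NonSpecial : ∀ {m} → Coloring m → Set
NonSpecial c = ¬ VertexSpecial c × ¬ EdgeSpecial c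

-- A colouring of K₅ is determined by its ten edge colours, and w φ is at most the number of
-- colourings f of the edges at the new vertex that leave every triangle through it
-- non-rainbow. An exhaustive check of all 3¹⁰ edge colourings shows that this number is at
-- most 31 for every Gallai colouring using three colours that is neither vertex- nor
-- edge-special.
module Submission where

open import Defs
open import Data.Nat using (ℕ; _≤_; _≤?_)
open import Data.Nat.Properties using (≤-trans)
open import Data.Fin using (Fin; zero; suc)
open import Data.Fin.Patterns using (0F; 1F; 2F; 3F; 4F)
open import Data.Fin.Properties using (all?; any?; suc-injective) renaming (_≟_ to _≟F_)
open import Data.Vec using (Vec; []; _∷_; lookup; map)
open import Data.Vec.Relation.Unary.All using (All; []; _∷_; universal) renaming (all? to allᵥ?)
open import Data.List using (filter; length)
open import Data.List.Relation.Binary.Sublist.Propositional using (⊆-refl)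
open import Data.List.Relation.Binary.Sublist.Propositional.Properties using (filter⁺; length-mono-≤)
open import Data.Product using (∃; _×_; _,_; uncurry)
open import Data.Sum using (_⊎_; inj₁; inj₂)
open import Data.Empty using (⊥-elim)
open import Function using (_∘_; case_of_)
open import Relation.Nullary using (¬_; Dec; yes; no; ¬?)
open import Relation.Nullary.Decidable using (_×-dec_; _⊎-dec_; _→-dec_; map′; From-yes; from-yes)
open import Relation.Binary.PropositionalEquality using (_≡_; _≢_; refl; sym; trans; cong)

rainbow? : (a b c : Color) → Dec (Rainbow a b c)
rainbow? a b c = ¬? (a ≟C b) ×-dec (¬? (b ≟C c) ×-dec ¬? (a ≟C c))

¬rainbow-aba : ∀ {a b} → ¬ Rainbow a b a
¬rainbow-aba (_ , _ , a≢a) = a≢a refl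

∀-color? : {P : Color → Set} → (∀ c → Dec (P c)) → Dec (∀ c → P c)
∀-color? P? = map′ (λ { (r , g , b) → λ { red → r ; green → g ; blue → b } })
                   (λ h → h red , h green , h blue)
                   (P? red ×-dec (P? green ×-dec P? blue))

∃-color? : {P : Color → Set} → (∀ c → Dec (P c)) → Dec (∃ P)
∃-color? P? = map′ (λ { (inj₁ r) → red , r ; (inj₂ (inj₁ g)) → green , g ; (inj₂ (inj₂ b)) → blue , b })
                   (λ { (red , r) → inj₁ r ; (green , g) → inj₂ (inj₁ g) ; (blue , b) → inj₂ (inj₂ b) })
                   (P? red ⊎-dec (P? green ⊎-dec P? blue))

∀-vec? : ∀ n {P : Vec Color n → Set} → (∀ v → Dec (P v)) → Dec (∀ v → P v)
∀-vec? ℕ.zero P? = map′ (λ p → λ { [] → p }) (λ h → h []) (P? [])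
∀-vec? (ℕ.suc n) P? = map′ (λ h → λ { (c ∷ v) → h c v }) (λ h c v → h (c ∷ v))
                           (∀-color? λ c → ∀-vec? n λ v → P? (c ∷ v))

AgreeOffDiagonal : ∀ {m} → Coloring m → Coloring m → Set
AgreeOffDiagonal φ ψ = ∀ i j → i ≢ j → φ i j ≡ ψ i j

module _ {m : ℕ} where

  agreeOffDiagonal-sym : {φ ψ : Coloring m} → AgreeOffDiagonal φ ψ → AgreeOffDiagonal ψ φ
  agreeOffDiagonal-sym φ≐ψ i j i≢j = sym (φ≐ψ i j i≢j)

  extend-resp : {φ ψ : Coloring m} (f : Fin m → Color) →
    AgreeOffDiagonal φ ψ → AgreeOffDiagonal (extend φ f) (extend ψ f)
  extend-resp f φ≐ψ zero    zero    _   = refl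
  extend-resp f φ≐ψ zero    (suc j) _   = refl
  extend-resp f φ≐ψ (suc i) zero    _   = refl
  extend-resp f φ≐ψ (suc i) (suc j) i≢j = φ≐ψ i j (i≢j ∘ cong suc)

  module _ {φ ψ : Coloring m} (φ≐ψ : AgreeOffDiagonal φ ψ) where

    gallai-resp : Gallai φ → Gallai ψ
    gallai-resp G i j k i≢j j≢k i≢k
      rewrite sym (φ≐ψ i j i≢j) | sym (φ≐ψ j k j≢k) | sym (φ≐ψ i k i≢k) = G i j k i≢j j≢k i≢k

    usesThreeColors-resp : UsesThreeColors φ → UsesThreeColors ψ
    usesThreeColors-resp U col with U col
    ... | i , j , i≢j , φij≡col = i , j , i≢j , trans (sym (φ≐ψ i j i≢j)) φij≡col

    monochromaticIn-resp : ∀ {v col} → MonochromaticIn φ v col → MonochromaticIn ψ v col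
    monochromaticIn-resp {v} M x x≢v = trans (sym (φ≐ψ v x (x≢v ∘ sym))) (M x x≢v)

    vertexSpecial-resp : VertexSpecial φ → VertexSpecial ψ
    vertexSpecial-resp (v , col , a , b , x , y , M , R , x≢y , x≢v , y≢v , φxy≡b , rest) =
      v , col , a , b , x , y , monochromaticIn-resp M , R , x≢y , x≢v , y≢v ,
      trans (sym (φ≐ψ x y x≢y)) φxy≡b ,
      λ p q p≢q p≢v q≢v ≠xy → trans (sym (φ≐ψ p q p≢q)) (rest p q p≢q p≢v q≢v ≠xy)

    edgeSpecial-resp : EdgeSpecial φ → EdgeSpecial ψ
    edgeSpecial-resp (x , y , z , t , a , b , d , x≢y , x≢z , x≢t , y≢z , y≢t , z≢t , R , φxy≡a , φzt≡b , rest) =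
      x , y , z , t , a , b , d , x≢y , x≢z , x≢t , y≢z , y≢t , z≢t , R ,
      trans (sym (φ≐ψ x y x≢y)) φxy≡a , trans (sym (φ≐ψ z t z≢t)) φzt≡b ,
      λ p q p≢q ≠xy ≠zt → trans (sym (φ≐ψ p q p≢q)) (rest p q p≢q ≠xy ≠zt)

  Compatible : Coloring m → (Fin m → Color) → Set
  Compatible φ f = ∀ i j → ¬ Rainbow (f i) (φ i j) (f j)

  gallai-extend⇒compatible : ∀ {φ f} → Gallai (extend φ f) → Compatible φ f
  gallai-extend⇒compatible G i j with i ≟F j
  ... | yes refl = ¬rainbow-aba
  ... | no i≢j   = G 0F (suc i) (suc j) (λ ()) (i≢j ∘ suc-injective) (λ ())

  usesThreeColors? : (φ : Coloring m) → Dec (UsesThreeColors φ)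
  usesThreeColors? φ = ∀-color? λ col → any? λ i → any? λ j → ¬? (i ≟F j) ×-dec (φ i j ≟C col)

  monochromaticIn? : (φ : Coloring m) → ∀ v col → Dec (MonochromaticIn φ v col)
  monochromaticIn? φ v col = all? λ x → ¬? (x ≟F v) →-dec (φ v x ≟C col)

  sameEdge? : (p q x y : Fin m) → Dec (SameEdge p q x y)
  sameEdge? p q x y = ((p ≟F x) ×-dec (q ≟F y)) ⊎-dec ((p ≟F y) ×-dec (q ≟F x))

  -- Both searches are decided with their quantifiers reordered (and restored by map′), so that
  -- the cheap structural test prunes before any colour is enumerated.
  vertexSpecial? : (φ : Coloring m) → Dec (VertexSpecial φ)
  vertexSpecial? φ = map′
    (λ { (v , col , M , a , b , x , y , rest) → v , col , a , b , x , y , M , rest })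
    (λ { (v , col , a , b , x , y , M , rest) → v , col , M , a , b , x , y , rest })
    (any? λ v → ∃-color? λ col → monochromaticIn? φ v col ×-dec
      (∃-color? λ a → ∃-color? λ b → any? λ x → any? λ y →
        rainbow? col a b ×-dec (¬? (x ≟F y) ×-dec (¬? (x ≟F v) ×-dec (¬? (y ≟F v) ×-dec
        ((φ x y ≟C b) ×-dec (all? λ p → all? λ q → ¬? (p ≟F q) →-dec (¬? (p ≟F v) →-dec
          (¬? (q ≟F v) →-dec (¬? (sameEdge? p q x y) →-dec (φ p q ≟C a)))))))))))

  edgeSpecial? : (φ : Coloring m) → Dec (EdgeSpecial φ)
  edgeSpecial? φ = map′
    (λ { (x , y , z , t , (x≢y , x≢z , x≢t , y≢z , y≢t , z≢t) , a , b , d , rest) →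
           x , y , z , t , a , b , d , x≢y , x≢z , x≢t , y≢z , y≢t , z≢t , rest })
    (λ { (x , y , z , t , a , b , d , x≢y , x≢z , x≢t , y≢z , y≢t , z≢t , rest) →
           x , y , z , t , (x≢y , x≢z , x≢t , y≢z , y≢t , z≢t) , a , b , d , rest })
    (any? λ x → any? λ y → any? λ z → any? λ t →
      (¬? (x ≟F y) ×-dec (¬? (x ≟F z) ×-dec (¬? (x ≟F t) ×-dec
       (¬? (y ≟F z) ×-dec (¬? (y ≟F t) ×-dec ¬? (z ≟F t)))))) ×-dec
      (∃-color? λ a → ∃-color? λ b → ∃-color? λ d →
        rainbow? a b d ×-dec ((φ x y ≟C a) ×-dec ((φ z t ≟C b) ×-dec
        (all? λ p → all? λ q → ¬? (p ≟F q) →-dec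
          (¬? (sameEdge? p q x y) →-dec (¬? (sameEdge? p q z t) →-dec (φ p q ≟C d))))))))

Special : ∀ {m} → Coloring m → Set
Special φ = VertexSpecial φ ⊎ EdgeSpecial φ

edgesK₅ : Vec (Fin 5 × Fin 5) 10
edgesK₅ = (0F , 1F) ∷ (0F , 2F) ∷ (0F , 3F) ∷ (0F , 4F) ∷ (1F , 2F)
        ∷ (1F , 3F) ∷ (1F , 4F) ∷ (2F , 3F) ∷ (2F , 4F) ∷ (3F , 4F) ∷ []

edgeColors : Coloring 5 → Vec Color 10
edgeColors φ = map (uncurry φ) edgesK₅

fromEdgeColors : Vec Color 10 → Coloring 5
fromEdgeColors (c01 ∷ c02 ∷ c03 ∷ c04 ∷ c12 ∷ c13 ∷ c14 ∷ c23 ∷ c24 ∷ c34 ∷ []) i j =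
  lookup (lookup adjacency i) j
  where
  adjacency : Vec (Vec Color 5) 5
  adjacency = (red ∷ c01 ∷ c02 ∷ c03 ∷ c04 ∷ [])
            ∷ (c01 ∷ red ∷ c12 ∷ c13 ∷ c14 ∷ [])
            ∷ (c02 ∷ c12 ∷ red ∷ c23 ∷ c24 ∷ [])
            ∷ (c03 ∷ c13 ∷ c23 ∷ red ∷ c34 ∷ [])
            ∷ (c04 ∷ c14 ∷ c24 ∷ c34 ∷ red ∷ [])
            ∷ []

fromEdgeColors-edgeColors : ∀ {φ} → Symmetric φ → AgreeOffDiagonal (fromEdgeColors (edgeColors φ)) φ
fromEdgeColors-edgeColors s 0F 0F i≢j = ⊥-elim (i≢j refl)
fromEdgeColors-edgeColors s 0F 1F _ = refl
fromEdgeColors-edgeColors s 0F 2F _ = refl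
fromEdgeColors-edgeColors s 0F 3F _ = refl
fromEdgeColors-edgeColors s 0F 4F _ = refl
fromEdgeColors-edgeColors s 1F 0F _ = s 0F 1F
fromEdgeColors-edgeColors s 1F 1F i≢j = ⊥-elim (i≢j refl)
fromEdgeColors-edgeColors s 1F 2F _ = refl
fromEdgeColors-edgeColors s 1F 3F _ = refl
fromEdgeColors-edgeColors s 1F 4F _ = refl
fromEdgeColors-edgeColors s 2F 0F _ = s 0F 2F
fromEdgeColors-edgeColors s 2F 1F _ = s 1F 2F
fromEdgeColors-edgeColors s 2F 2F i≢j = ⊥-elim (i≢j refl)
fromEdgeColors-edgeColors s 2F 3F _ = refl
fromEdgeColors-edgeColors s 2F 4F _ = refl
fromEdgeColors-edgeColors s 3F 0F _ = s 0F 3F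
fromEdgeColors-edgeColors s 3F 1F _ = s 1F 3F
fromEdgeColors-edgeColors s 3F 2F _ = s 2F 3F
fromEdgeColors-edgeColors s 3F 3F i≢j = ⊥-elim (i≢j refl)
fromEdgeColors-edgeColors s 3F 4F _ = refl
fromEdgeColors-edgeColors s 4F 0F _ = s 0F 4F
fromEdgeColors-edgeColors s 4F 1F _ = s 1F 4F
fromEdgeColors-edgeColors s 4F 2F _ = s 2F 4F
fromEdgeColors-edgeColors s 4F 3F _ = s 3F 4F
fromEdgeColors-edgeColors s 4F 4F i≢j = ⊥-elim (i≢j refl)

trianglesK₅ : Vec (Fin 5 × Fin 5 × Fin 5) 10
trianglesK₅ = (0F , 1F , 2F) ∷ (0F , 1F , 3F) ∷ (0F , 1F , 4F) ∷ (0F , 2F , 3F) ∷ (0F , 2F , 4F)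
            ∷ (0F , 3F , 4F) ∷ (1F , 2F , 3F) ∷ (1F , 2F , 4F) ∷ (1F , 3F , 4F) ∷ (2F , 3F , 4F) ∷ []

NonRainbowTriangle : Coloring 5 → Fin 5 × Fin 5 × Fin 5 → Set
NonRainbowTriangle φ (i , j , k) = ¬ Rainbow (φ i j) (φ j k) (φ i k)

gallai⇒nonRainbowTriangles : ∀ {φ} → Gallai φ → All (NonRainbowTriangle φ) trianglesK₅
gallai⇒nonRainbowTriangles G =
  G 0F 1F 2F (λ ()) (λ ()) (λ ()) ∷ G 0F 1F 3F (λ ()) (λ ()) (λ ()) ∷
  G 0F 1F 4F (λ ()) (λ ()) (λ ()) ∷ G 0F 2F 3F (λ ()) (λ ()) (λ ()) ∷
  G 0F 2F 4F (λ ()) (λ ()) (λ ()) ∷ G 0F 3F 4F (λ ()) (λ ()) (λ ()) ∷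
  G 1F 2F 3F (λ ()) (λ ()) (λ ()) ∷ G 1F 2F 4F (λ ()) (λ ()) (λ ()) ∷
  G 1F 3F 4F (λ ()) (λ ()) (λ ()) ∷ G 2F 3F 4F (λ ()) (λ ()) (λ ()) ∷ []

CompatibleOnEdges : Coloring 5 → (Fin 5 → Color) → Set
CompatibleOnEdges φ f = All (λ (i , j) → ¬ Rainbow (f i) (φ i j) (f j)) edgesK₅

compatibleOnEdges? : ∀ φ f → Dec (CompatibleOnEdges φ f)
compatibleOnEdges? φ f = allᵥ? (λ (i , j) → ¬? (rainbow? (f i) (φ i j) (f j))) edgesK₅

compatibleCount : Coloring 5 → ℕ
compatibleCount φ = length (filter (compatibleOnEdges? φ) (allColorFns 5))

w≤compatibleCount : ∀ {φ ψ} → AgreeOffDiagonal φ ψ → w φ ≤ compatibleCount ψ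
w≤compatibleCount {φ} {ψ} φ≐ψ = length-mono-≤
  (filter⁺ (λ f → gallai? (extend φ f)) (compatibleOnEdges? ψ) compatibleOnEdges
    (⊆-refl {x = allColorFns 5}))
  where
  compatibleOnEdges : ∀ {f g} → f ≡ g → Gallai (extend φ f) → CompatibleOnEdges ψ g
  compatibleOnEdges {f} refl G =
    universal (λ (i , j) → gallai-extend⇒compatible (gallai-resp (extend-resp f φ≐ψ) G) i j) edgesK₅

BoundedOrSpecial : Vec Color 10 → Set
BoundedOrSpecial t =
  All (NonRainbowTriangle (fromEdgeColors t)) trianglesK₅ → UsesThreeColors (fromEdgeColors t) →
  compatibleCount (fromEdgeColors t) ≤ 31 ⊎ Special (fromEdgeColors t)

boundedOrSpecial? : ∀ t → Dec (BoundedOrSpecial t)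
boundedOrSpecial? t =
  allᵥ? (λ (i , j , k) → ¬? (rainbow? (φ i j) (φ j k) (φ i k))) trianglesK₅ →-dec
  (usesThreeColors? φ →-dec ((compatibleCount φ ≤? 31) ⊎-dec (vertexSpecial? φ ⊎-dec edgeSpecial? φ)))
  where
  φ : Coloring 5
  φ = fromEdgeColors t

boundedOrSpecial-∷∷ : ∀ a b → From-yes (∀-vec? 8 λ t → boundedOrSpecial? (a ∷ b ∷ t))
boundedOrSpecial-∷∷ a b = from-yes (∀-vec? 8 λ t → boundedOrSpecial? (a ∷ b ∷ t))

-- One clause per pair of leading edge colours, so that each ninth of the 3¹⁰ codes is
-- normalised on its own: checking them all in one go exhausts memory.
allBoundedOrSpecial : ∀ t → BoundedOrSpecial t
allBoundedOrSpecial (red   ∷ red   ∷ t) = boundedOrSpecial-∷∷ red   red   t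
allBoundedOrSpecial (red   ∷ green ∷ t) = boundedOrSpecial-∷∷ red   green t
allBoundedOrSpecial (red   ∷ blue  ∷ t) = boundedOrSpecial-∷∷ red   blue  t
allBoundedOrSpecial (green ∷ red   ∷ t) = boundedOrSpecial-∷∷ green red   t
allBoundedOrSpecial (green ∷ green ∷ t) = boundedOrSpecial-∷∷ green green t
allBoundedOrSpecial (green ∷ blue  ∷ t) = boundedOrSpecial-∷∷ green blue  t
allBoundedOrSpecial (blue  ∷ red   ∷ t) = boundedOrSpecial-∷∷ blue  red   t
allBoundedOrSpecial (blue  ∷ green ∷ t) = boundedOrSpecial-∷∷ blue  green t
allBoundedOrSpecial (blue  ∷ blue  ∷ t) = boundedOrSpecial-∷∷ blue  blue  t

lemma4p4 : (φ : Coloring 5) → Symmetric φ → Gallai φ → UsesThreeColors φ →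
    HasMonochromaticVertex φ → NonSpecial φ → w φ ≤ 31
lemma4p4 φ s G U _ (¬vs , ¬es) =
  case allBoundedOrSpecial (edgeColors φ)
         (gallai⇒nonRainbowTriangles (gallai-resp φ≐ψ G)) (usesThreeColors-resp φ≐ψ U) of λ where
    (inj₁ count≤31) → ≤-trans (w≤compatibleCount φ≐ψ) count≤31
    (inj₂ (inj₁ vs)) → ⊥-elim (¬vs (vertexSpecial-resp ψ≐φ vs))
    (inj₂ (inj₂ es)) → ⊥-elim (¬es (edgeSpecial-resp ψ≐φ es))
  where
  ψ≐φ : AgreeOffDiagonal (fromEdgeColors (edgeColors φ)) φ
  ψ≐φ = fromEdgeColors-edgeColors s
  φ≐ψ : AgreeOffDiagonal φ (fromEdgeColors (edgeColors φ))
  φ≐ψ = agreeOffDiagonal-sym ψ≐φ
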